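{- The axiom (Ex) is valid in every ortholattice; that is, every ortholattice is an Ex-lattice.
   Context: A fundamental lattice is a bounded lattice with unary $\lnot$ that is antitone, satisfies $a\wedge\lnot a=0$ and $a\le\lnot\lnot a$. An ortholattice is a fundamental lattice with $\lnot\lnot a=a$ for all $a$. (Ex) is the inequality, required for all elements $a,b,c,d,e,f$: $\lnot\big[a\wedge((b\wedge c)\vee(b\wedge d))\big]\wedge a\wedge(c\vee e)\wedge\lnot\lnot f \le \lnot\lnot(a\wedge f)\wedge\big[(a\wedge c)\vee(a\wedge e)\vee f\big]\wedge\big[(b\wedge(c\vee d))\vee\lnot(b\wedge(c\vee d))\big]$. An Ex-lattice is a fundamental lattice satisfying (Ex). -}

module Defs where

open import Level using (Level; _⊔_; suc)
open import Relation.Binary.Lattice.Bundles using (BoundedLattice)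

record FundamentalLattice (c ℓ₁ ℓ₂ : Level) : Set (suc (c ⊔ ℓ₁ ⊔ ℓ₂)) where
  field
    boundedLattice : BoundedLattice c ℓ₁ ℓ₂
  open BoundedLattice boundedLattice public
  field
    ¬_           : Carrier → Carrier
    ¬-antitone   : ∀ {a b} → a ≤ b → (¬ b) ≤ (¬ a)
    ∧-¬-bot      : ∀ a → (a ∧ (¬ a)) ≈ ⊥
    ≤-¬¬         : ∀ a → a ≤ (¬ (¬ a))
  infix 8 ¬_

IsOrtholattice : ∀ {c ℓ₁ ℓ₂} → FundamentalLattice c ℓ₁ ℓ₂ → Set (c ⊔ ℓ₁)
IsOrtholattice L = ∀ a → (¬ (¬ a)) ≈ a
  where open FundamentalLattice L

Ex : ∀ {c ℓ₁ ℓ₂} → FundamentalLattice c ℓ₁ ℓ₂ → Set (c ⊔ ℓ₂)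
Ex L = ∀ a b c d e f →
  ((((¬ (a ∧ ((b ∧ c) ∨ (b ∧ d)))) ∧ a) ∧ (c ∨ e)) ∧ (¬ (¬ f)))
    ≤ (((¬ (¬ (a ∧ f))) ∧ (((a ∧ c) ∨ (a ∧ e)) ∨ f))
        ∧ ((b ∧ (c ∨ d)) ∨ (¬ (b ∧ (c ∨ d)))))
  where open FundamentalLattice L

IsExLattice : ∀ {c ℓ₁ ℓ₂} → FundamentalLattice c ℓ₁ ℓ₂ → Set (c ⊔ ℓ₂)
IsExLattice L = Ex L

{-# OPTIONS --safe #-}
module Submission where

open import Defs
open import Level using (Level)
import Relation.Binary.Reasoning.PartialOrder as PartialOrderReasoning

-- In an ortholattice ¬ ¬ f = f, so the left-hand side of (Ex) lies below a ∧ f and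
-- hence below the first two conjuncts on the right; the third conjunct is x ∨ ¬ x,
-- which is ⊤ because already ⊤ ≤ ¬ ¬ (x ∨ ¬ x) holds in every fundamental lattice.

module FundamentalLatticeProperties {c ℓ₁ ℓ₂} (L : FundamentalLattice c ℓ₁ ℓ₂) where
  open FundamentalLattice L
  open PartialOrderReasoning poset

  ⊤≤¬⊥ : ⊤ ≤ ¬ ⊥
  ⊤≤¬⊥ = begin
    ⊤       ≤⟨ ≤-¬¬ ⊤ ⟩
    ¬ ¬ ⊤   ≤⟨ ¬-antitone (minimum (¬ ⊤)) ⟩
    ¬ ⊥     ∎

  ¬-∨-≤ : ∀ x y → ¬ (x ∨ y) ≤ ¬ x ∧ ¬ y
  ¬-∨-≤ x y = ∧-greatest (¬-antitone (x≤x∨y x y)) (¬-antitone (y≤x∨y x y))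

  ¬[x∨¬x]≤⊥ : ∀ x → ¬ (x ∨ ¬ x) ≤ ⊥
  ¬[x∨¬x]≤⊥ x = begin
    ¬ (x ∨ ¬ x)    ≤⟨ ¬-∨-≤ x (¬ x) ⟩
    ¬ x ∧ ¬ ¬ x    ≈⟨ ∧-¬-bot (¬ x) ⟩
    ⊥              ∎

  ⊤≤¬¬[x∨¬x] : ∀ x → ⊤ ≤ ¬ ¬ (x ∨ ¬ x)
  ⊤≤¬¬[x∨¬x] x = trans ⊤≤¬⊥ (¬-antitone (¬[x∨¬x]≤⊥ x))

module OrtholatticeProperties {c ℓ₁ ℓ₂} (L : FundamentalLattice c ℓ₁ ℓ₂)
                              (¬¬-involutive : IsOrtholattice L) where
  open FundamentalLattice L
  open FundamentalLatticeProperties L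

  ¬¬-elim : ∀ x → ¬ ¬ x ≤ x
  ¬¬-elim x = reflexive (¬¬-involutive x)

  excluded-middle : ∀ x → ⊤ ≤ x ∨ ¬ x
  excluded-middle x = trans (⊤≤¬¬[x∨¬x] x) (¬¬-elim (x ∨ ¬ x))

lemma3p2 : ∀ {c ℓ₁ ℓ₂ : Level} (L : FundamentalLattice c ℓ₁ ℓ₂)
    → IsOrtholattice L → IsExLattice L
lemma3p2 L ¬¬-involutive a b c d e f =
  ∧-greatest (∧-greatest lhs≤¬¬[a∧f] lhs≤[a∧c∨a∧e]∨f) lhs≤x∨¬x
  where
  open FundamentalLattice L
  open OrtholatticeProperties L ¬¬-involutive

  lhs : Carrier
  lhs = (((¬ (a ∧ ((b ∧ c) ∨ (b ∧ d)))) ∧ a) ∧ (c ∨ e)) ∧ (¬ (¬ f))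

  lhs≤a : lhs ≤ a
  lhs≤a = trans (x∧y≤x _ _) (trans (x∧y≤x _ _) (x∧y≤y _ _))

  lhs≤f : lhs ≤ f
  lhs≤f = trans (x∧y≤y _ _) (¬¬-elim f)

  lhs≤¬¬[a∧f] : lhs ≤ ¬ ¬ (a ∧ f)
  lhs≤¬¬[a∧f] = trans (∧-greatest lhs≤a lhs≤f) (≤-¬¬ (a ∧ f))

  lhs≤[a∧c∨a∧e]∨f : lhs ≤ ((a ∧ c) ∨ (a ∧ e)) ∨ f
  lhs≤[a∧c∨a∧e]∨f = trans lhs≤f (y≤x∨y _ f)

  lhs≤x∨¬x : lhs ≤ (b ∧ (c ∨ d)) ∨ ¬ (b ∧ (c ∨ d))
  lhs≤x∨¬x = trans (maximum lhs) (excluded-middle (b ∧ (c ∨ d)))
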